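{- Let $1\le k\le n$ and $u,w\in S_n$, and suppose $u$ is anti-Grassmannian of type $(k,n)$. If $w\ge u$ in Bruhat order, then $w\ge_k u$.
   Context: A permutation is anti-Grassmannian of type $(k,n)$ if it is decreasing on $[k]$ and on $[k+1,n]$. The $k$-Bruhat order $\le_k$ is the reflexive-transitive closure of the relations $u\lessdot_k w$, meaning $w$ covers $u$ in Bruhat order and $w([k])\ne u([k])$, where $u([k])=\{u(1),\dots,u(k)\}$. -}

module Defs where

open import Data.Nat using (ℕ; _<_; _≤_)
open import Data.Fin using (Fin; toℕ)
import Data.Fin as F
open import Data.Fin.Permutation using (Permutation′; _⟨$⟩ʳ_; _≈_) public
open import Data.List using (List; length; filter; allFin; cartesianProduct)
open import Data.Product using (Σ; Σ-syntax; ∃; _×_; _,_; proj₁; proj₂)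
open import Data.Empty using (⊥)
open import Relation.Nullary using (¬_; Dec)
open import Relation.Nullary.Decidable using (_×-dec_)
open import Relation.Binary.PropositionalEquality using (_≡_; _≢_)
open import Function.Bundles using (_⇔_)

-- Permutations of [n] = {0,…,n-1} (0-indexed; position i ↔ paper's i+1).
Perm : ℕ → Set
Perm = Permutation′

isInv : ∀ {n} (u : Perm n) (p : Fin n × Fin n) → Dec (proj₁ p F.< proj₂ p × u ⟨$⟩ʳ proj₂ p F.< u ⟨$⟩ʳ proj₁ p)
isInv u (i , j) = (i F.<? j) ×-dec ((u ⟨$⟩ʳ j) F.<? (u ⟨$⟩ʳ i))

ℓ : ∀ {n} → Perm n → ℕ
ℓ {n} u = length (filter (isInv u) (cartesianProduct (allFin n) (allFin n)))

-- w = u · t_{ij}: w is u with the values at positions i and j swapped.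
IsSwap : ∀ {n} → Perm n → Fin n → Fin n → Perm n → Set
IsSwap u i j w =
  (w ⟨$⟩ʳ i ≡ u ⟨$⟩ʳ j) × (w ⟨$⟩ʳ j ≡ u ⟨$⟩ʳ i) ×
  (∀ x → x ≢ i → x ≢ j → w ⟨$⟩ʳ x ≡ u ⟨$⟩ʳ x)

BruhatStep : ∀ {n} → Perm n → Perm n → Set
BruhatStep {n} u w = Σ[ i ∈ Fin n ] Σ[ j ∈ Fin n ] (i F.< j × IsSwap u i j w × ℓ u < ℓ w)

data _≤B_ {n : ℕ} : Perm n → Perm n → Set where
  ≤B-refl : ∀ {u w} → u ≈ w → u ≤B w
  ≤B-step : ∀ {u v w} → u ≤B v → BruhatStep v w → u ≤B w

_<B_ : ∀ {n} → Perm n → Perm n → Set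
u <B w = u ≤B w × ¬ (u ≈ w)

_⋖B_ : ∀ {n} → Perm n → Perm n → Set
_⋖B_ {n} u w = u <B w × (∀ (z : Perm n) → u <B z → z <B w → ⊥)

-- u([k]) = {u(1),…,u(k)} (0-indexed positions 0..k-1); equality of these sets.
SameTopSet : ∀ {n} → ℕ → Perm n → Perm n → Set
SameTopSet {n} k u w = ∀ (v : Fin n) →
  (Σ[ i ∈ Fin n ] (toℕ i < k × u ⟨$⟩ʳ i ≡ v)) ⇔ (Σ[ i ∈ Fin n ] (toℕ i < k × w ⟨$⟩ʳ i ≡ v))

_⋖[_]_ : ∀ {n} → Perm n → ℕ → Perm n → Set
u ⋖[ k ] w = u ⋖B w × ¬ SameTopSet k u w

data _≤[_]_ {n : ℕ} : Perm n → ℕ → Perm n → Set where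
  ≤k-refl : ∀ {k u w} → u ≈ w → u ≤[ k ] w
  ≤k-step : ∀ {k u v w} → u ≤[ k ] v → v ⋖[ k ] w → u ≤[ k ] w

AntiGrassmannian : ∀ {n} → ℕ → Perm n → Set
AntiGrassmannian {n} k u =
  (∀ (i j : Fin n) → i F.< j → toℕ j < k → u ⟨$⟩ʳ j F.< u ⟨$⟩ʳ i) ×
  (∀ (i j : Fin n) → i F.< j → k ≤ toℕ i → u ⟨$⟩ʳ j F.< u ⟨$⟩ʳ i)

module Submission where

-- Say that w dominates u when u(a) ≤ w(a) at every position a < k and
-- w(b) ≤ u(b) at every position b ≥ k (positions are 0-indexed).
--  (1) A Bruhat step swaps an ascent (length bookkeeping below); since u
--      decreases on both blocks, such a swap preserves domination.  Hence
--      u ≤ w implies that w dominates u.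
--  (2) If w dominates u and w ≠ u, then w has a k-descent: positions
--      a < k ≤ b with u(a) ≤ w(b) < w(a) ≤ u(b).  Shrinking it with the help
--      of the anti-Grassmannian property makes it tight: no position between
--      a and b carries a value between w(b) and w(a).
--  (3) Undoing a tight k-descent, v = w·t_ab, gives a k-Bruhat cover v ⋖_k w
--      (swapping two values with nothing in between changes the length by
--      one, and the value w(b) enters the first k positions), and v still
--      dominates u.  Induction on ℓ(w) yields a chain of k-covers u → w.
-- The length computations rest on an involution of position pairs matching
-- the inversions of x·t_ij with those of x, and on counting over lists.

open import Defs
open import Data.Nat as ℕ using (ℕ; zero; suc; _≤_; _<_; _+_; _∸_; z≤n; s≤s)
open import Data.Nat.Properties
open import Data.Fin as F using (Fin; toℕ)
import Data.Fin.Properties as FP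
open import Data.Fin.Permutation using (inverseˡ; inverseʳ; _⟨$⟩ˡ_; transpose; _∘ₚ_)
import Data.Fin.Permutation.Components as PC
open import Data.List using (List; []; _∷_; length; filter; map; allFin; cartesianProduct)
open import Data.List.Properties using (filter-none)
open import Data.List.Membership.Propositional using (_∈_)
open import Data.List.Membership.Propositional.Properties using (∈-map⁺; ∈-cartesianProduct⁺; ∈-allFin)
import Data.List.Membership.Propositional.Properties.WithK as ∈-WithK
open import Data.List.Relation.Unary.Any using (here; there)
import Data.List.Relation.Unary.All as All
open import Data.List.Relation.Unary.AllPairs using (_∷_)
open import Data.List.Relation.Unary.Unique.Propositional using (Unique)
open import Data.List.Relation.Unary.Unique.Propositional.Properties using (map⁺; cartesianProduct⁺; allFin⁺)
open import Data.List.Relation.Binary.BagAndSetEquality using (∼bag⇒↭)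
open import Data.List.Relation.Binary.Permutation.Propositional using (_↭_)
open import Data.List.Relation.Binary.Permutation.Propositional.Properties using (↭-length; filter-↭)
open import Data.List.Relation.Binary.Sublist.Propositional using (⊆-refl)
open import Data.List.Relation.Binary.Sublist.Propositional.Properties using (filter⁺)
open import Data.List.Relation.Binary.Sublist.Heterogeneous.Properties using (length-mono-≤)
open import Data.Product using (∃-syntax; _×_; _,_; proj₁; proj₂)
import Data.Product.Properties as ×
open import Data.Sum using (_⊎_; inj₁; inj₂)
open import Data.Empty using (⊥; ⊥-elim)
open import Function using (_∘_)
open import Function.Bundles using (mk⇔; Equivalence)
open import Function.Definitions using (Injective)
open import Relation.Nullary using (¬_; Dec; yes; no)
open import Relation.Nullary.Decidable using (_×-dec_; _⊎-dec_; dec-true; dec-false)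
open import Relation.Unary using (Decidable)
open import Relation.Binary.Definitions using (DecidableEquality; tri<; tri≈; tri>)
open import Relation.Binary.PropositionalEquality
  using (_≡_; _≢_; refl; sym; trans; cong; cong₂; subst; subst₂)

module Counting {A : Set} where

  count : {P : A → Set} → Decidable P → List A → ℕ
  count P? xs = length (filter P? xs)

  count-mono : ∀ {P Q : A → Set} (P? : Decidable P) (Q? : Decidable Q) →
    (∀ x → P x → Q x) → ∀ xs → count P? xs ≤ count Q? xs
  count-mono P? Q? P⇒Q xs = length-mono-≤ (filter⁺ P? Q? (λ { refl → P⇒Q _ }) (⊆-refl {x = xs}))

  count-mono-< : ∀ {P Q : A → Set} (P? : Decidable P) (Q? : Decidable Q) →
    (∀ x → P x → Q x) → ∀ {y} xs → y ∈ xs → Q y → ¬ P y → count P? xs < count Q? xs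
  count-mono-< P? Q? P⇒Q (x ∷ xs) (here refl) Qx ¬Px with P? x | Q? x
  ... | yes Px | _      = ⊥-elim (¬Px Px)
  ... | no _   | yes _  = s≤s (count-mono P? Q? P⇒Q xs)
  ... | no _   | no ¬Qx = ⊥-elim (¬Qx Qx)
  count-mono-< P? Q? P⇒Q (x ∷ xs) (there y∈xs) Qy ¬Py with P? x | Q? x
  ... | yes _  | yes _  = s≤s (count-mono-< P? Q? P⇒Q xs y∈xs Qy ¬Py)
  ... | yes Px | no ¬Qx = ⊥-elim (¬Qx (P⇒Q x Px))
  ... | no _   | yes _  = m<n⇒m<1+n (count-mono-< P? Q? P⇒Q xs y∈xs Qy ¬Py)
  ... | no _   | no _   = count-mono-< P? Q? P⇒Q xs y∈xs Qy ¬Py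

  count-⊎ : ∀ {P R : A → Set} (P? : Decidable P) (R? : Decidable R) → ∀ xs →
    count (λ x → P? x ⊎-dec R? x) xs ≤ count P? xs + count R? xs
  count-⊎ P? R? [] = z≤n
  count-⊎ P? R? (x ∷ xs) with P? x | R? x
  ... | yes _ | yes _ = s≤s (≤-trans (count-⊎ P? R? xs) (+-monoʳ-≤ (count P? xs) (n≤1+n _)))
  ... | yes _ | no _  = s≤s (count-⊎ P? R? xs)
  ... | no _  | yes _ rewrite +-suc (count P? xs) (count R? xs) = s≤s (count-⊎ P? R? xs)
  ... | no _  | no _  = count-⊎ P? R? xs

  count-≡-≤1 : (_≟_ : DecidableEquality A) (y : A) → ∀ xs → Unique xs → count (_≟ y) xs ≤ 1
  count-≡-≤1 _≟_ y [] _ = z≤n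
  count-≡-≤1 _≟_ y (x ∷ xs) (x∉xs ∷ xs-unique) with x ≟ y
  ... | yes refl = s≤s (≤-reflexive (cong length
                     (filter-none (_≟ y) (All.map (λ x≢z z≡x → x≢z (sym z≡x)) x∉xs))))
  ... | no _ = count-≡-≤1 _≟_ y xs xs-unique

  count-map : ∀ {P : A → Set} (P? : Decidable P) (ψ : A → A) → ∀ xs →
    count P? (map ψ xs) ≡ count (P? ∘ ψ) xs
  count-map P? ψ [] = refl
  count-map P? ψ (x ∷ xs) with P? (ψ x)
  ... | yes _ = cong suc (count-map P? ψ xs)
  ... | no _  = count-map P? ψ xs

  count-involution : ∀ {P : A → Set} (P? : Decidable P) (ψ : A → A) → (∀ x → ψ (ψ x) ≡ x) →
    ∀ xs → Unique xs → (∀ x → x ∈ xs) → count P? xs ≡ count (P? ∘ ψ) xs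
  count-involution P? ψ ψψ xs xs-unique complete =
    trans (sym (↭-length (filter-↭ P? ψxs↭xs))) (count-map P? ψ xs)
    where
    ψ-injective : ∀ {x y} → ψ x ≡ ψ y → x ≡ y
    ψ-injective {x} {y} e = trans (sym (ψψ x)) (trans (cong ψ e) (ψψ y))
    ψxs↭xs : map ψ xs ↭ xs
    ψxs↭xs = ∼bag⇒↭ (∈-WithK.unique∧set⇒bag (map⁺ ψ-injective xs-unique) xs-unique
      (λ {x} → mk⇔ (λ _ → complete _) (λ _ → subst (_∈ map ψ xs) (ψψ x) (∈-map⁺ ψ (complete (ψ x))))))

open Counting

perm-injective : ∀ {n} (x : Perm n) → Injective _≡_ _≡_ (x ⟨$⟩ʳ_)
perm-injective x {r} {s} e = trans (sym (inverseˡ x)) (trans (cong (x ⟨$⟩ˡ_) e) (inverseˡ x))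

injective-hits : ∀ {n} (h : Fin n → Fin n) → Injective _≡_ _≡_ h → ∀ a → ¬ (∀ p → a ≢ h p)
injective-hits {suc m} h h-injective a misses =
  FP.<⇒notInjective (n<1+n m) (h-injective ∘ FP.punchOut-injective (misses _) (misses _))

≉⇒inverses-differ : ∀ {n} (u w : Perm n) → ¬ (u ≈ w) → ¬ (∀ c → u ⟨$⟩ˡ c ≡ w ⟨$⟩ˡ c)
≉⇒inverses-differ u w u≉w same = u≉w λ p →
  trans (sym (inverseʳ w)) (cong (w ⟨$⟩ʳ_) (trans (sym (same (u ⟨$⟩ʳ p))) (inverseˡ u)))

least-difference : ∀ {n} (u w : Perm n) → ¬ (u ≈ w) →
  ∃[ c ] (u ⟨$⟩ˡ c ≢ w ⟨$⟩ˡ c) × (∀ p → w ⟨$⟩ʳ p F.< c → u ⟨$⟩ʳ p ≡ w ⟨$⟩ʳ p)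
least-difference {n} u w u≉w
  with FP.¬∀⟶∃¬-smallest n _ (λ c → u ⟨$⟩ˡ c F.≟ w ⟨$⟩ˡ c) (≉⇒inverses-differ u w u≉w)
... | c , c-differs , inverses-agree-below = c , c-differs , agree
  where
  agree : ∀ p → w ⟨$⟩ʳ p F.< c → u ⟨$⟩ʳ p ≡ w ⟨$⟩ʳ p
  agree p wp<c = trans (cong (u ⟨$⟩ʳ_) (sym u⁻¹wp≡p)) (inverseʳ u)
    where
    wp′ : Fin (toℕ c)
    wp′ = F.fromℕ< wp<c
    wp′≡wp : F.inject wp′ ≡ w ⟨$⟩ʳ p
    wp′≡wp = FP.toℕ-injective (trans (FP.toℕ-inject wp′) (FP.toℕ-fromℕ< wp<c))
    u⁻¹wp≡p : u ⟨$⟩ˡ (w ⟨$⟩ʳ p) ≡ p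
    u⁻¹wp≡p = trans (subst (λ z → u ⟨$⟩ˡ z ≡ w ⟨$⟩ˡ z) wp′≡wp (inverses-agree-below wp′)) (inverseˡ w)

-- If w sends into a set S every position that u sends into S, then the
-- converse holds too: both preimages of S have the same size.
preimage-⊆⇒⊇ : ∀ {n} (u w : Perm n) {S : Fin n → Set} → Decidable S →
  (∀ p → S (u ⟨$⟩ʳ p) → S (w ⟨$⟩ʳ p)) → ∀ p → S (w ⟨$⟩ʳ p) → S (u ⟨$⟩ʳ p)
preimage-⊆⇒⊇ {n} u w {S} S? u⇒w a Swa with S? (u ⟨$⟩ʳ a)
... | yes Sua = Sua
... | no ¬Sua = ⊥-elim (injective-hits h h-injective a h-misses-a)
  where
  -- h is injective on positions and never takes the value a: the positions
  -- p with S(w p) are sent to u⁻¹(w p), which lies in u⁻¹(S) ∌ a.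
  h′ : (p : Fin n) → Dec (S (w ⟨$⟩ʳ p)) → Fin n
  h′ p (yes _) = u ⟨$⟩ˡ (w ⟨$⟩ʳ p)
  h′ p (no _)  = p
  h : Fin n → Fin n
  h p = h′ p (S? (w ⟨$⟩ʳ p))
  S-u∘h : ∀ p → S (w ⟨$⟩ʳ p) → S (u ⟨$⟩ʳ (u ⟨$⟩ˡ (w ⟨$⟩ʳ p)))
  S-u∘h p Swp = subst S (sym (inverseʳ u)) Swp
  h-misses-a : ∀ p → a ≢ h p
  h-misses-a p with S? (w ⟨$⟩ʳ p)
  ... | yes Swp = λ a≡hp → ¬Sua (subst (S ∘ (u ⟨$⟩ʳ_)) (sym a≡hp) (S-u∘h p Swp))
  ... | no ¬Swp = λ a≡p → ¬Swp (subst (S ∘ (w ⟨$⟩ʳ_)) a≡p Swa)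
  h-injective : Injective _≡_ _≡_ h
  h-injective {p} {q} with S? (w ⟨$⟩ʳ p) | S? (w ⟨$⟩ʳ q)
  ... | yes _   | yes _   = λ e → perm-injective w (trans (sym (inverseʳ u)) (trans (cong (u ⟨$⟩ʳ_) e) (inverseʳ u)))
  ... | yes Swp | no ¬Swq = λ e → ⊥-elim (¬Swq (u⇒w q (subst (S ∘ (u ⟨$⟩ʳ_)) e (S-u∘h p Swp))))
  ... | no ¬Swp | yes Swq = λ e → ⊥-elim (¬Swp (u⇒w p (subst (S ∘ (u ⟨$⟩ʳ_)) (sym e) (S-u∘h q Swq))))
  ... | no _    | no _    = λ e → e

Inversion : ∀ {n} → Perm n → Fin n × Fin n → Set
Inversion u (r , s) = r F.< s × u ⟨$⟩ʳ s F.< u ⟨$⟩ʳ r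

Pairs : (n : ℕ) → List (Fin n × Fin n)
Pairs n = cartesianProduct (allFin n) (allFin n)

Pairs-unique : ∀ n → Unique (Pairs n)
Pairs-unique n = cartesianProduct⁺ (allFin⁺ n) (allFin⁺ n)

Pairs-complete : ∀ n (p : Fin n × Fin n) → p ∈ Pairs n
Pairs-complete n (r , s) = ∈-cartesianProduct⁺ (∈-allFin r) (∈-allFin s)

ℓ-resp-≈ : ∀ {n} {x y : Perm n} → x ≈ y → ℓ x ≡ ℓ y
ℓ-resp-≈ {n} {x} {y} x≈y =
  ≤-antisym (count-mono (isInv x) (isInv y) (transfer {x} {y} x≈y) (Pairs n))
            (count-mono (isInv y) (isInv x) (transfer {y} {x} (sym ∘ x≈y)) (Pairs n))
  where
  transfer : ∀ {x y : Perm n} → x ≈ y → ∀ p → Inversion x p → Inversion y p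
  transfer e (r , s) (r<s , xs<xr) = r<s , subst₂ F._<_ (e s) (e r) xs<xr

IsSwap-sym : ∀ {n} {x y : Perm n} {i j} → IsSwap x i j y → IsSwap y i j x
IsSwap-sym (yi , yj , yo) = sym yj , sym yi , λ r r≢i r≢j → sym (yo r r≢i r≢j)

NoValueBetween : ∀ {n} → Perm n → Fin n → Fin n → Set
NoValueBetween y i j =
  ∀ r → i F.< r → r F.< j → y ⟨$⟩ʳ j F.< y ⟨$⟩ʳ r → y ⟨$⟩ʳ r F.< y ⟨$⟩ʳ i → ⊥

module Transposition {n : ℕ} {i j : Fin n} (i<j : i F.< j) where

  i≢j : i ≢ j
  i≢j = FP.<⇒≢ i<j

  τ : Fin n → Fin n
  τ = PC.transpose i j

  τ-i : τ i ≡ j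
  τ-i rewrite dec-true (i F.≟ i) refl = refl

  τ-j : τ j ≡ i
  τ-j rewrite dec-false (j F.≟ i) (i≢j ∘ sym) | dec-true (j F.≟ j) refl = refl

  τ-other : ∀ r → r ≢ i → r ≢ j → τ r ≡ r
  τ-other r r≢i r≢j rewrite dec-false (r F.≟ i) r≢i | dec-false (r F.≟ j) r≢j = refl

  data Place (r : Fin n) : Set where
    at-i  : r ≡ i → Place r
    at-j  : r ≡ j → Place r
    other : r ≢ i → r ≢ j → Place r

  place : ∀ r → Place r
  place r with r F.≟ i | r F.≟ j
  ... | yes r≡i | _       = at-i r≡i
  ... | no _    | yes r≡j = at-j r≡j
  ... | no r≢i  | no r≢j  = other r≢i r≢j

  τ-involutive : ∀ r → τ (τ r) ≡ r
  τ-involutive r with place r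
  ... | at-i refl       = trans (cong τ τ-i) τ-j
  ... | at-j refl       = trans (cong τ τ-j) τ-i
  ... | other r≢i r≢j   = trans (cong τ (τ-other r r≢i r≢j)) (τ-other r r≢i r≢j)

  _·t : Perm n → Perm n
  x ·t = transpose i j ∘ₚ x

  ·t-isSwap : ∀ x → IsSwap x i j (x ·t)
  ·t-isSwap x = cong (x ⟨$⟩ʳ_) τ-i , cong (x ⟨$⟩ʳ_) τ-j ,
                λ r r≢i r≢j → cong (x ⟨$⟩ʳ_) (τ-other r r≢i r≢j)

  isSwap-τ : ∀ {x y : Perm n} → IsSwap x i j y → ∀ r → y ⟨$⟩ʳ r ≡ x ⟨$⟩ʳ τ r
  isSwap-τ {x} (yi , yj , yo) r with place r
  ... | at-i refl     = trans yi (cong (x ⟨$⟩ʳ_) (sym τ-i))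
  ... | at-j refl     = trans yj (cong (x ⟨$⟩ʳ_) (sym τ-j))
  ... | other r≢i r≢j = trans (yo r r≢i r≢j) (cong (x ⟨$⟩ʳ_) (sym (τ-other r r≢i r≢j)))

  Between : Fin n → Set
  Between r = i F.< r × r F.< j

  between? : ∀ r → Dec (Between r)
  between? r = (i F.<? r) ×-dec (r F.<? j)

  between-≢i : ∀ {r} → Between r → r ≢ i
  between-≢i (i<r , _) refl = FP.<-irrefl refl i<r

  between-≢j : ∀ {r} → Between r → r ≢ j
  between-≢j (_ , r<j) refl = FP.<-irrefl refl r<j

  -- τ only moves i and j, neither of which is strictly between them.
  τ-not-between : ∀ r → ¬ Between r → ¬ Between (τ r)
  τ-not-between r ¬btw with place r
  ... | at-i refl     = λ btw → between-≢j btw τ-i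
  ... | at-j refl     = λ btw → between-≢i btw τ-j
  ... | other r≢i r≢j = subst (λ z → ¬ Between z) (sym (τ-other r r≢i r≢j)) ¬btw

  beyond-j : ∀ {s} → i F.< s → ¬ Between s → s ≢ j → j F.< s
  beyond-j {s} i<s ¬btw s≢j with FP.<-cmp s j
  ... | tri< s<j _ _ = ⊥-elim (¬btw (i<s , s<j))
  ... | tri≈ _ s≡j _ = ⊥-elim (s≢j s≡j)
  ... | tri> _ _ j<s = j<s

  before-i : ∀ {r} → r F.< j → ¬ Between r → r ≢ i → r F.< i
  before-i {r} r<j ¬btw r≢i with FP.<-cmp r i
  ... | tri< r<i _ _ = r<i
  ... | tri≈ _ r≡i _ = ⊥-elim (r≢i r≡i)
  ... | tri> _ _ i<r = ⊥-elim (¬btw (i<r , r<j))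

  _≟-pair_ : DecidableEquality (Fin n × Fin n)
  _≟-pair_ = ×.≡-dec F._≟_ F._≟_

  τ-mono : ∀ {r s} → ¬ Between r → ¬ Between s → r F.< s → (r , s) ≢ (i , j) → τ r F.< τ s
  τ-mono {r} {s} ¬btw-r ¬btw-s r<s not-ij with place r | place s
  ... | at-i refl     | at-i refl     = ⊥-elim (FP.<-irrefl refl r<s)
  ... | at-i refl     | at-j refl     = ⊥-elim (not-ij refl)
  ... | at-i refl     | other s≢i s≢j =
    subst₂ F._<_ (sym τ-i) (sym (τ-other s s≢i s≢j)) (beyond-j r<s ¬btw-s s≢j)
  ... | at-j refl     | at-i refl     = ⊥-elim (FP.<-asym r<s i<j)
  ... | at-j refl     | at-j refl     = ⊥-elim (FP.<-irrefl refl r<s)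
  ... | at-j refl     | other s≢i s≢j =
    subst₂ F._<_ (sym τ-j) (sym (τ-other s s≢i s≢j)) (FP.<-trans i<j r<s)
  ... | other r≢i r≢j | at-i refl     =
    subst₂ F._<_ (sym (τ-other r r≢i r≢j)) (sym τ-i) (FP.<-trans r<s i<j)
  ... | other r≢i r≢j | at-j refl     =
    subst₂ F._<_ (sym (τ-other r r≢i r≢j)) (sym τ-j) (before-i r<s ¬btw-r r≢i)
  ... | other r≢i r≢j | other s≢i s≢j =
    subst₂ F._<_ (sym (τ-other r r≢i r≢j)) (sym (τ-other s s≢i s≢j)) r<s

  -- The involution of position pairs matching inversions of x·t_ij with
  -- inversions of x: pairs with an entry strictly between i and j are kept,
  -- the others are moved by τ in both entries.
  ψ : Fin n × Fin n → Fin n × Fin n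
  ψ (r , s) with between? r | between? s
  ... | yes _ | _     = (r , s)
  ... | no _  | yes _ = (r , s)
  ... | no _  | no _  = (τ r , τ s)

  ψ-outside : ∀ r s → ¬ Between r → ¬ Between s → ψ (r , s) ≡ (τ r , τ s)
  ψ-outside r s ¬btw-r ¬btw-s with between? r | between? s
  ... | yes btw | _       = ⊥-elim (¬btw-r btw)
  ... | no _    | yes btw = ⊥-elim (¬btw-s btw)
  ... | no _    | no _    = refl

  ψ-involutive : ∀ p → ψ (ψ p) ≡ p
  ψ-involutive (r , s) with between? r | between? s
  ... | yes btw-r | _ with between? r
  ...   | yes _      = refl
  ...   | no ¬btw-r  = ⊥-elim (¬btw-r btw-r)
  ψ-involutive (r , s) | no ¬btw-r | yes btw-s with between? r | between? s
  ...   | yes btw-r | _          = ⊥-elim (¬btw-r btw-r)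
  ...   | no _      | yes _      = refl
  ...   | no _      | no ¬btw-s  = ⊥-elim (¬btw-s btw-s)
  ψ-involutive (r , s) | no ¬btw-r | no ¬btw-s =
    trans (ψ-outside (τ r) (τ s) (τ-not-between r ¬btw-r) (τ-not-between s ¬btw-s))
          (cong₂ _,_ (τ-involutive r) (τ-involutive s))

  -- ψ exchanges (j,i), never an inversion, with (i,j).
  ψ-ji : ψ (j , i) ≡ (i , j)
  ψ-ji = trans (ψ-outside j i (λ btw → between-≢j btw refl) (λ btw → between-≢i btw refl))
               (cong₂ _,_ τ-j τ-i)

  -- No position between i and j carries a value strictly between x(i) and
  -- x(j); stated so that it holds vacuously when x(j) < x(i).
  Gapless : Perm n → Set
  Gapless x = ∀ r → Between r →
    (x ⟨$⟩ʳ i F.< x ⟨$⟩ʳ r → x ⟨$⟩ʳ j F.< x ⟨$⟩ʳ r) × (x ⟨$⟩ʳ r F.< x ⟨$⟩ʳ j → x ⟨$⟩ʳ r F.< x ⟨$⟩ʳ i)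

  descent-gapless : ∀ x → x ⟨$⟩ʳ j F.< x ⟨$⟩ʳ i → Gapless x
  descent-gapless x xj<xi r _ = (FP.<-trans xj<xi) , (λ xr<xj → FP.<-trans xr<xj xj<xi)

  inversion-transfer : ∀ {x y} → IsSwap x i j y → Gapless x →
    ∀ p → Inversion y p → Inversion x (ψ p) ⊎ p ≡ (i , j)
  inversion-transfer {x} {y} sw@(yi , yj , yo) gap (r , s) (r<s , ys<yr)
    with between? r | between? s
  -- r between i and j: ψ keeps the pair and only s can be moved by the swap,
  -- namely if s = j, where gaplessness applies.
  ... | yes btw-r | _ with s F.≟ j
  ...   | yes refl = inj₁ (r<s , proj₁ (gap r btw-r) (subst₂ F._<_ yj yr≡xr ys<yr))
    where
    yr≡xr : y ⟨$⟩ʳ r ≡ x ⟨$⟩ʳ r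
    yr≡xr = yo r (between-≢i btw-r) (between-≢j btw-r)
  ...   | no s≢j   = inj₁ (r<s , subst₂ F._<_ (yo s s≢i s≢j) yr≡xr ys<yr)
    where
    yr≡xr : y ⟨$⟩ʳ r ≡ x ⟨$⟩ʳ r
    yr≡xr = yo r (between-≢i btw-r) (between-≢j btw-r)
    s≢i : s ≢ i
    s≢i s≡i = FP.<-asym (proj₁ btw-r) (subst (r F.<_) s≡i r<s)
  inversion-transfer {x} {y} (yi , yj , yo) gap (r , s) (r<s , ys<yr)
    | no ¬btw-r | yes btw-s with r F.≟ i
  -- s between i and j: symmetric, with r = i the critical case.
  ...   | yes refl = inj₁ (r<s , proj₂ (gap s btw-s) (subst₂ F._<_ ys≡xs yi ys<yr))
    where
    ys≡xs : y ⟨$⟩ʳ s ≡ x ⟨$⟩ʳ s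
    ys≡xs = yo s (between-≢i btw-s) (between-≢j btw-s)
  ...   | no r≢i   = inj₁ (r<s , subst₂ F._<_ ys≡xs (yo r r≢i r≢j) ys<yr)
    where
    ys≡xs : y ⟨$⟩ʳ s ≡ x ⟨$⟩ʳ s
    ys≡xs = yo s (between-≢i btw-s) (between-≢j btw-s)
    r≢j : r ≢ j
    r≢j r≡j = FP.<-asym (proj₂ btw-s) (subst (F._< s) r≡j r<s)
  inversion-transfer {x} {y} sw gap (r , s) (r<s , ys<yr)
    | no ¬btw-r | no ¬btw-s with (r , s) ≟-pair (i , j)
  -- neither between: ψ applies τ to both entries, which keeps their order.
  ... | yes rs≡ij = inj₂ rs≡ij
  ... | no rs≢ij  = inj₁ (τ-mono ¬btw-r ¬btw-s r<s rs≢ij ,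
                          subst₂ F._<_ (isSwap-τ {x} {y} sw s) (isSwap-τ {x} {y} sw r) ys<yr)

  length-descent : ∀ {x y} → IsSwap x i j y → x ⟨$⟩ʳ j F.< x ⟨$⟩ʳ i → ℓ y < ℓ x
  length-descent {x} {y} sw xj<xi = begin-strict
      ℓ y
    <⟨ count-mono-< (isInv y) (isInv x ∘ ψ) transfer (Pairs n) (Pairs-complete n (j , i)) ji↦inv ji-not-inv ⟩
      count (isInv x ∘ ψ) (Pairs n)
    ≡⟨ count-involution (isInv x) ψ ψ-involutive (Pairs n) (Pairs-unique n) (Pairs-complete n) ⟨
      ℓ x
    ∎
    where
    open ≤-Reasoning
    transfer : ∀ p → Inversion y p → Inversion x (ψ p)
    transfer p inv with inversion-transfer {x} {y} sw (descent-gapless x xj<xi) p inv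
    ... | inj₁ inv′ = inv′
    ... | inj₂ refl = ⊥-elim (FP.<-asym xj<xi (subst₂ F._<_ (proj₁ (proj₂ sw)) (proj₁ sw) (proj₂ inv)))
    ji↦inv : Inversion x (ψ (j , i))
    ji↦inv = subst (Inversion x) (sym ψ-ji) (i<j , xj<xi)
    ji-not-inv : ¬ Inversion y (j , i)
    ji-not-inv (j<i , _) = FP.<-asym j<i i<j

  length-≤-suc : ∀ {x y} → IsSwap x i j y → Gapless x → ℓ y ≤ suc (ℓ x)
  length-≤-suc {x} {y} sw gap = begin
      ℓ y
    ≤⟨ count-mono (isInv y) (λ p → isInv x (ψ p) ⊎-dec (p ≟-pair (i , j))) (inversion-transfer {x} {y} sw gap) (Pairs n) ⟩
      count (λ p → isInv x (ψ p) ⊎-dec (p ≟-pair (i , j))) (Pairs n)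
    ≤⟨ count-⊎ (isInv x ∘ ψ) (_≟-pair (i , j)) (Pairs n) ⟩
      count (isInv x ∘ ψ) (Pairs n) + count (_≟-pair (i , j)) (Pairs n)
    ≤⟨ +-monoʳ-≤ (count (isInv x ∘ ψ) (Pairs n)) (count-≡-≤1 _≟-pair_ (i , j) (Pairs n) (Pairs-unique n)) ⟩
      count (isInv x ∘ ψ) (Pairs n) + 1
    ≡⟨ cong (_+ 1) (count-involution (isInv x) ψ ψ-involutive (Pairs n) (Pairs-unique n) (Pairs-complete n)) ⟨
      ℓ x + 1
    ≡⟨ +-comm (ℓ x) 1 ⟩
      suc (ℓ x)
    ∎
    where open ≤-Reasoning

-- A Bruhat step swaps an ascent: swapping a descent would decrease ℓ.
bruhatStep-ascent : ∀ {n} {v w : Perm n} {i j} → i F.< j → IsSwap v i j w → ℓ v < ℓ w →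
  v ⟨$⟩ʳ i F.< v ⟨$⟩ʳ j
bruhatStep-ascent {v = v} {w} {i} {j} i<j sw ℓv<ℓw with FP.<-cmp (v ⟨$⟩ʳ i) (v ⟨$⟩ʳ j)
... | tri< vi<vj _ _ = vi<vj
... | tri≈ _ vi≡vj _ = ⊥-elim (FP.<⇒≢ i<j (perm-injective v vi≡vj))
... | tri> _ _ vj<vi = ⊥-elim (<-asym ℓv<ℓw (Transposition.length-descent i<j {v} {w} sw vj<vi))

ℓ-mono : ∀ {n} {x y : Perm n} → x ≤B y → ℓ x ≤ ℓ y
ℓ-mono {x = x} {y} (≤B-refl x≈y) = ≤-reflexive (ℓ-resp-≈ {x = x} {y} x≈y)
ℓ-mono (≤B-step x≤v (_ , _ , _ , _ , ℓv<ℓy)) = ≤-trans (ℓ-mono x≤v) (<⇒≤ ℓv<ℓy)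

ℓ-mono-< : ∀ {n} {x y : Perm n} → x <B y → ℓ x < ℓ y
ℓ-mono-< (≤B-refl x≈y , x≉y) = ⊥-elim (x≉y x≈y)
ℓ-mono-< (≤B-step x≤v (_ , _ , _ , _ , ℓv<ℓy) , _) = ≤-<-trans (ℓ-mono x≤v) ℓv<ℓy

-- Undoing a descent i < j of y whose values have no intermediate value at
-- an intermediate position is a Bruhat cover x ⋖ y: x < y by one step, and
-- the lengths differ by exactly one.
undo-descent-cover : ∀ {n} {x y : Perm n} {i j} → i F.< j → IsSwap y i j x →
  y ⟨$⟩ʳ j F.< y ⟨$⟩ʳ i → NoValueBetween y i j → x ⋖B y
undo-descent-cover {n} {x} {y} {i} {j} i<j sw@(xi , xj , xo) yj<yi no-value = (x≤y , x≉y) , no-middle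
  where
  open Transposition i<j
  ℓx<ℓy : ℓ x < ℓ y
  ℓx<ℓy = length-descent {y} {x} sw yj<yi
  x≤y : x ≤B y
  x≤y = ≤B-step {v = x} (≤B-refl (λ _ → refl)) (i , j , i<j , IsSwap-sym {x = y} {x} sw , ℓx<ℓy)
  x≉y : ¬ (x ≈ y)
  x≉y x≈y = FP.<⇒≢ i<j (sym (perm-injective y (trans (sym xi) (x≈y i))))
  gapless : Gapless x
  gapless r btw = above , below
    where
    xr≡yr : x ⟨$⟩ʳ r ≡ y ⟨$⟩ʳ r
    xr≡yr = xo r (between-≢i btw) (between-≢j btw)
    above : x ⟨$⟩ʳ i F.< x ⟨$⟩ʳ r → x ⟨$⟩ʳ j F.< x ⟨$⟩ʳ r
    above xi<xr with FP.<-cmp (y ⟨$⟩ʳ r) (y ⟨$⟩ʳ i)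
    ... | tri< yr<yi _ _ = ⊥-elim (no-value r (proj₁ btw) (proj₂ btw) (subst₂ F._<_ xi xr≡yr xi<xr) yr<yi)
    ... | tri≈ _ yr≡yi _ = ⊥-elim (between-≢i btw (perm-injective y yr≡yi))
    ... | tri> _ _ yi<yr = subst₂ F._<_ (sym xj) (sym xr≡yr) yi<yr
    below : x ⟨$⟩ʳ r F.< x ⟨$⟩ʳ j → x ⟨$⟩ʳ r F.< x ⟨$⟩ʳ i
    below xr<xj with FP.<-cmp (y ⟨$⟩ʳ r) (y ⟨$⟩ʳ j)
    ... | tri< yr<yj _ _ = subst₂ F._<_ (sym xr≡yr) (sym xi) yr<yj
    ... | tri≈ _ yr≡yj _ = ⊥-elim (between-≢j btw (perm-injective y yr≡yj))
    ... | tri> _ _ yj<yr = ⊥-elim (no-value r (proj₁ btw) (proj₂ btw) yj<yr (subst₂ F._<_ xr≡yr xj xr<xj))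
  no-middle : ∀ z → x <B z → z <B y → ⊥
  no-middle z x<z z<y = <-irrefl refl (<-≤-trans (≤-<-trans (ℓ-mono-< {x = x} {z} x<z) (ℓ-mono-< {x = z} {y} z<y))
                                                 (length-≤-suc {x} {y} (IsSwap-sym {x = y} {x} sw) gapless))

module Domination {n : ℕ} (k : ℕ) (u : Perm n) where

  Dominates : Perm n → Set
  Dominates w = (∀ a → toℕ a < k → u ⟨$⟩ʳ a F.≤ w ⟨$⟩ʳ a) ×
                (∀ b → k ≤ toℕ b → w ⟨$⟩ʳ b F.≤ u ⟨$⟩ʳ b)

  dominates-refl : ∀ {w} → u ≈ w → Dominates w
  dominates-refl u≈w = (λ a _ → FP.≤-reflexive (u≈w a)) , (λ b _ → FP.≤-reflexive (sym (u≈w b)))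

  -- Swapping an ascent preserves domination when u decreases on both blocks:
  -- the new value at a position is either larger (first block) / smaller
  -- (second block) than before, or it is bounded via the monotonicity of u.
  dominates-ascent : AntiGrassmannian k u → ∀ {v w i j} → i F.< j → IsSwap v i j w →
    v ⟨$⟩ʳ i F.< v ⟨$⟩ʳ j → Dominates v → Dominates w
  dominates-ascent (dec-top , dec-bot) {v} {w} {i} {j} i<j (wi , wj , wo) vi<vj (top , bot) = top′ , bot′
    where
    open Transposition i<j using (place; at-i; at-j; other)
    top′ : ∀ a → toℕ a < k → u ⟨$⟩ʳ a F.≤ w ⟨$⟩ʳ a
    top′ a a<k with place a
    ... | at-i refl     = subst (u ⟨$⟩ʳ a F.≤_) (sym wi) (<⇒≤ (≤-<-trans (top a a<k) vi<vj))
    ... | at-j refl     = subst (u ⟨$⟩ʳ a F.≤_) (sym wj)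
                            (<⇒≤ (<-≤-trans (dec-top i a i<j a<k) (top i (<-trans i<j a<k))))
    ... | other a≢i a≢j = subst (u ⟨$⟩ʳ a F.≤_) (sym (wo a a≢i a≢j)) (top a a<k)
    bot′ : ∀ b → k ≤ toℕ b → w ⟨$⟩ʳ b F.≤ u ⟨$⟩ʳ b
    bot′ b k≤b with place b
    ... | at-j refl     = subst (F._≤ u ⟨$⟩ʳ b) (sym wj) (<⇒≤ (<-≤-trans vi<vj (bot b k≤b)))
    ... | at-i refl     = subst (F._≤ u ⟨$⟩ʳ b) (sym wi)
                            (<⇒≤ (≤-<-trans (bot j (≤-trans k≤b (<⇒≤ i<j))) (dec-bot b j i<j k≤b)))
    ... | other b≢i b≢j = subst (F._≤ u ⟨$⟩ʳ b) (sym (wo b b≢i b≢j)) (bot b k≤b)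

  bruhat⇒dominates : AntiGrassmannian k u → ∀ {w} → u ≤B w → Dominates w
  bruhat⇒dominates ag {w} (≤B-refl u≈w) = dominates-refl {w} u≈w
  bruhat⇒dominates ag (≤B-step {v = v} {w} u≤v (i , j , i<j , sw , ℓv<ℓw)) =
    dominates-ascent ag {v} {w} i<j sw (bruhatStep-ascent {v = v} {w} i<j sw ℓv<ℓw) (bruhat⇒dominates ag u≤v)

  record KDescent (w : Perm n) (a b : Fin n) : Set where
    field
      a<k  : toℕ a < k
      k≤b  : k ≤ toℕ b
      low  : u ⟨$⟩ʳ a F.≤ w ⟨$⟩ʳ b
      desc : w ⟨$⟩ʳ b F.< w ⟨$⟩ʳ a
      high : w ⟨$⟩ʳ a F.≤ u ⟨$⟩ʳ b

    a<b : a F.< b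
    a<b = <-≤-trans a<k k≤b

  -- Otherwise every position with
  -- u-value ≥ w(a) would keep a w-value ≥ w(a) (on the first block by
  -- domination); counting then forces the converse, which fails at a.
  value-pushed-down : ∀ {w} → Dominates w → ∀ a → u ⟨$⟩ʳ a F.< w ⟨$⟩ʳ a →
    ∃[ b ] (k ≤ toℕ b × w ⟨$⟩ʳ b F.< w ⟨$⟩ʳ a × w ⟨$⟩ʳ a F.≤ u ⟨$⟩ʳ b)
  value-pushed-down {w} (top , _) a ua<wa
    with FP.any? (λ b → (k ℕ.≤? toℕ b) ×-dec ((w ⟨$⟩ʳ b F.<? w ⟨$⟩ʳ a) ×-dec (w ⟨$⟩ʳ a F.≤? u ⟨$⟩ʳ b)))
  ... | yes found = found
  ... | no none = ⊥-elim (<⇒≱ ua<wa (preimage-⊆⇒⊇ u w (w ⟨$⟩ʳ a F.≤?_) stays-large a ≤-refl))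
    where
    stays-large : ∀ p → w ⟨$⟩ʳ a F.≤ u ⟨$⟩ʳ p → w ⟨$⟩ʳ a F.≤ w ⟨$⟩ʳ p
    stays-large p wa≤up with toℕ p ℕ.<? k | w ⟨$⟩ʳ a F.≤? w ⟨$⟩ʳ p
    ... | yes p<k | _         = ≤-trans wa≤up (top p p<k)
    ... | no _    | yes wa≤wp = wa≤wp
    ... | no p≮k  | no wa≰wp  = ⊥-elim (none (p , ≮⇒≥ p≮k , ≰⇒> wa≰wp , wa≤up))

  -- Let c be the least value whose
  -- positions in u and w differ and a = u⁻¹(c).  Domination forces a < k
  -- (a position b ≥ k has w(b) ≤ u(b), and w(a) < c is excluded as u, w agree
  -- there) and then c < w(a); the pushed-down position b completes the
  -- k-descent, with c ≤ w(b) since u and w agree on values below c.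
  kdescent-exists : ∀ {w} → Dominates w → ¬ (u ≈ w) → ∃[ a ] ∃[ b ] KDescent w a b
  kdescent-exists {w} dom@(top , bot) u≉w with least-difference u w u≉w
  ... | c , c-differs , agree = a , b , record
    { a<k = a<k ; k≤b = k≤b ; low = low ; desc = wb<wa ; high = wa≤ub }
    where
    a : Fin n
    a = u ⟨$⟩ˡ c

    ua≡c : u ⟨$⟩ʳ a ≡ c
    ua≡c = inverseʳ u

    wa≢c : w ⟨$⟩ʳ a ≢ c
    wa≢c wa≡c = c-differs (sym (trans (cong (w ⟨$⟩ˡ_) (sym wa≡c)) (inverseˡ w)))

    a<k : toℕ a < k
    a<k with toℕ a ℕ.<? k
    ... | yes a<k = a<k
    ... | no a≮k = ⊥-elim (wa≢c (trans (sym (agree a wa<c)) ua≡c))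
      where
      wa<c : w ⟨$⟩ʳ a F.< c
      wa<c = FP.≤∧≢⇒< (subst (w ⟨$⟩ʳ a F.≤_) ua≡c (bot a (≮⇒≥ a≮k))) wa≢c

    ua<wa : u ⟨$⟩ʳ a F.< w ⟨$⟩ʳ a
    ua<wa = FP.≤∧≢⇒< (top a a<k) (λ ua≡wa → wa≢c (trans (sym ua≡wa) ua≡c))

    pushed : ∃[ b ] (k ≤ toℕ b × w ⟨$⟩ʳ b F.< w ⟨$⟩ʳ a × w ⟨$⟩ʳ a F.≤ u ⟨$⟩ʳ b)
    pushed = value-pushed-down {w} dom a ua<wa
    b : Fin n
    b = proj₁ pushed
    k≤b : k ≤ toℕ b
    k≤b = proj₁ (proj₂ pushed)
    wb<wa : w ⟨$⟩ʳ b F.< w ⟨$⟩ʳ a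
    wb<wa = proj₁ (proj₂ (proj₂ pushed))
    wa≤ub : w ⟨$⟩ʳ a F.≤ u ⟨$⟩ʳ b
    wa≤ub = proj₂ (proj₂ (proj₂ pushed))

    low : u ⟨$⟩ʳ a F.≤ w ⟨$⟩ʳ b
    low with w ⟨$⟩ʳ b F.<? c
    ... | yes wb<c = ⊥-elim (<⇒≱ wb<wa (subst (w ⟨$⟩ʳ a F.≤_) (agree b wb<c) wa≤ub))
    ... | no wb≮c  = subst (F._≤ w ⟨$⟩ʳ b) (sym ua≡c) (≮⇒≥ wb≮c)

  -- Since u decreases on both blocks, an
  -- intermediate position c can replace a (if c < k) or b (if c ≥ k); the
  -- fuel bounds the distance b - a.
  tighten : AntiGrassmannian k u → ∀ w (fuel : ℕ) {a b} → toℕ b ∸ toℕ a < fuel → KDescent w a b →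
    ∃[ a′ ] ∃[ b′ ] KDescent w a′ b′ × NoValueBetween w a′ b′
  tighten ag w zero () _
  tighten ag@(dec-top , dec-bot) w (suc fuel) {a} {b} b-a<fuel d
    with FP.any? (λ c → (a F.<? c) ×-dec ((c F.<? b) ×-dec ((w ⟨$⟩ʳ b F.<? w ⟨$⟩ʳ c) ×-dec (w ⟨$⟩ʳ c F.<? w ⟨$⟩ʳ a))))
  ... | no none = a , b , d , λ c a<c c<b wb<wc wc<wa → none (c , a<c , c<b , wb<wc , wc<wa)
  ... | yes (c , a<c , c<b , wb<wc , wc<wa) with toℕ c ℕ.<? k
  ...   | yes c<k = tighten ag w fuel (<-≤-trans (∸-monoʳ-< a<c (<⇒≤ c<b)) (ℕ.s≤s⁻¹ b-a<fuel)) record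
    { a<k = c<k ; k≤b = k≤b ; low = ≤-trans (<⇒≤ (dec-top a c a<c c<k)) low
    ; desc = wb<wc ; high = ≤-trans (<⇒≤ wc<wa) high }
    where open KDescent d
  ...   | no c≮k = tighten ag w fuel (<-≤-trans (∸-monoˡ-< c<b (<⇒≤ a<c)) (ℕ.s≤s⁻¹ b-a<fuel)) record
    { a<k = a<k ; k≤b = ≮⇒≥ c≮k ; low = ≤-trans low (<⇒≤ wb<wc)
    ; desc = wc<wa ; high = ≤-trans high (<⇒≤ (dec-bot c b c<b (≮⇒≥ c≮k))) }
    where open KDescent d

  module _ {w : Perm n} {a b : Fin n} (d : KDescent w a b) where
    open KDescent d
    open Transposition a<b using (_·t; ·t-isSwap; place; at-i; at-j; other)

    -- Undoing a tight k-descent is a k-Bruhat cover: it is a Bruhat cover,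
    -- and w(b) is in the first block of w·t_ab but not of w.
    tight-kdescent-cover : NoValueBetween w a b → (w ·t) ⋖[ k ] w
    tight-kdescent-cover tight = undo-descent-cover a<b (·t-isSwap w) desc tight , moves-top-set
      where
      moves-top-set : ¬ SameTopSet k (w ·t) w
      moves-top-set same with Equivalence.to (same (w ⟨$⟩ʳ b)) (a , a<k , proj₁ (·t-isSwap w))
      ... | r , r<k , wr≡wb = <⇒≱ (subst (λ z → toℕ z < k) (perm-injective w wr≡wb) r<k) k≤b

    kdescent-dominates : Dominates w → Dominates (w ·t)
    kdescent-dominates (top , bot) = top′ , bot′
      where
      va : (w ·t) ⟨$⟩ʳ a ≡ w ⟨$⟩ʳ b
      va = proj₁ (·t-isSwap w)
      vb : (w ·t) ⟨$⟩ʳ b ≡ w ⟨$⟩ʳ a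
      vb = proj₁ (proj₂ (·t-isSwap w))
      vo : ∀ r → r ≢ a → r ≢ b → (w ·t) ⟨$⟩ʳ r ≡ w ⟨$⟩ʳ r
      vo = proj₂ (proj₂ (·t-isSwap w))
      top′ : ∀ a′ → toℕ a′ < k → u ⟨$⟩ʳ a′ F.≤ (w ·t) ⟨$⟩ʳ a′
      top′ a′ a′<k with place a′
      ... | at-i refl         = subst (u ⟨$⟩ʳ a′ F.≤_) (sym va) low
      ... | at-j refl         = ⊥-elim (<⇒≱ a′<k k≤b)
      ... | other a′≢a a′≢b = subst (u ⟨$⟩ʳ a′ F.≤_) (sym (vo a′ a′≢a a′≢b)) (top a′ a′<k)
      bot′ : ∀ b′ → k ≤ toℕ b′ → (w ·t) ⟨$⟩ʳ b′ F.≤ u ⟨$⟩ʳ b′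
      bot′ b′ k≤b′ with place b′
      ... | at-i refl         = ⊥-elim (<⇒≱ a<k k≤b′)
      ... | at-j refl         = subst (F._≤ u ⟨$⟩ʳ b′) (sym vb) high
      ... | other b′≢a b′≢b = subst (F._≤ u ⟨$⟩ʳ b′) (sym (vo b′ b′≢a b′≢b)) (bot b′ k≤b′)

  dominates⇒≤k : AntiGrassmannian k u → ∀ (fuel : ℕ) w → ℓ w < fuel → Dominates w → u ≤[ k ] w
  dominates⇒≤k ag zero w () _
  dominates⇒≤k ag (suc fuel) w ℓw<fuel dom with FP.all? (λ p → u ⟨$⟩ʳ p F.≟ w ⟨$⟩ʳ p)
  ... | yes u≈w = ≤k-refl u≈w
  ... | no u≉w with kdescent-exists {w} dom u≉w
  ...   | a₀ , b₀ , d₀ with tighten ag w (suc (toℕ b₀ ∸ toℕ a₀)) (n<1+n _) d₀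
  ...     | a , b , d , tight = ≤k-step (dominates⇒≤k ag fuel v ℓv<fuel (kdescent-dominates d dom)) v⋖w
    where
    v : Perm n
    v = Transposition._·t (KDescent.a<b d) w
    v⋖w : v ⋖[ k ] w
    v⋖w = tight-kdescent-cover d tight
    ℓv<fuel : ℓ v < fuel
    ℓv<fuel = <-≤-trans (ℓ-mono-< {x = v} {w} (proj₁ (proj₁ v⋖w))) (ℕ.s≤s⁻¹ ℓw<fuel)

lemma3p4 : (n k : ℕ) → 1 ≤ k → k ≤ n → (u w : Perm n) →
    AntiGrassmannian k u → u ≤B w → u ≤[ k ] w
lemma3p4 n k _ _ u w ag u≤w =
  dominates⇒≤k ag (suc (ℓ w)) w (n<1+n (ℓ w)) (bruhat⇒dominates ag u≤w)
  where open Domination k u
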